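{- Let $G$ be a finite simple graph. If $x,y$ are vertices of $G$ with $N_G[x]\subseteq N_G[y]$ and $\deg_G(y)\geq 2$, then $G$ is not a $\theta$-prime graph.
   Context: For a finite simple graph $G$, $\theta(G)$ is defined recursively by: $\theta(G)=0$ if $G$ has no edges, and otherwise $\theta(G)=\min_{v}\max\{\theta(G-v),\ \theta(G-N_G[v])+1\}$, the minimum over non-isolated vertices $v$, where $N_G[v]$ is the closed neighborhood of $v$ (this is the theta-number of the independence complex of $G$). $G$ is $\theta$-prime if $\theta(G-v)<\theta(G)$ for every vertex $v$ of $G$. -}

module Defs where

open import Data.Nat using (ℕ; zero; suc; _+_; _⊓_; _⊔_)
open import Data.Bool using (Bool; true; false; _∨_; _∧_; not; if_then_else_)
open import Data.Fin using (Fin; _≟_)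
open import Data.Fin.Subset using (Subset; _∩_; ∁; ⁅_⁆; ⊤; ∣_∣)
open import Data.Vec using (Vec; tabulate; lookup)
open import Data.List using (List; []; _∷_; foldr; mapMaybe)
open import Data.Bool.ListAction using (any)
open import Data.List using () renaming (allFin to allFinL)
open import Data.Maybe using (Maybe; just; nothing)
open import Relation.Binary.PropositionalEquality using (_≡_)
open import Relation.Nullary.Decidable using (⌊_⌋)

record Graph (n : ℕ) : Set where
  field
    adj    : Fin n → Fin n → Bool
    sym    : ∀ u v → adj u v ≡ adj v u
    irrefl : ∀ v → adj v v ≡ false
open Graph public

module _ {n : ℕ} (G : Graph n) where

  closedNbhd : Fin n → Subset n
  closedNbhd v = tabulate (λ u → ⌊ u ≟ v ⌋ ∨ adj G u v)

  openNbhd : Fin n → Subset n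
  openNbhd v = tabulate (λ u → adj G v u)

  deg : Fin n → ℕ
  deg v = ∣ openNbhd v ∣

  nonIsolatedIn : Subset n → Fin n → Bool
  nonIsolatedIn S v =
    lookup S v ∧ any (λ u → lookup S u ∧ adj G v u) (allFinL n)

  minList : List ℕ → ℕ
  minList []       = 0
  minList (x ∷ xs) = foldr _⊓_ x xs

  -- θ of the induced subgraph G[S], computed with fuel k (k ≥ |S| suffices,
  -- since every recursive call removes at least one vertex of S).
  -- If G[S] has no edges, there is no non-isolated vertex and the value is 0.
  θ-fuel : ℕ → Subset n → ℕ
  θ-fuel zero    S = 0
  θ-fuel (suc k) S = minList (mapMaybe cand (allFinL n))
    where
    cand : Fin n → Maybe ℕ
    cand v = if nonIsolatedIn S v
             then just (θ-fuel k (S ∩ ∁ ⁅ v ⁆) ⊔ suc (θ-fuel k (S ∩ ∁ (closedNbhd v))))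
             else nothing

  θ-induced : Subset n → ℕ
  θ-induced S = θ-fuel n S

  θ : ℕ
  θ = θ-induced ⊤

  θ-del : Fin n → ℕ
  θ-del v = θ-induced (∁ ⁅ v ⁆)

open import Data.Nat using (_<_)

θ-prime : ∀ {n} → Graph n → Set
θ-prime G = ∀ v → θ-del G v < θ G

{-# OPTIONS --safe #-}
-- Write θ[ S ] for θ of the subgraph induced on S.  Branching at any vertex v gives
-- θ[ S ] ≤ max (θ[ S − v ], 1 + θ[ S − N[v] ]), and θ is monotone under induced subgraphs.
-- If N[x] ⊆ N[y] with x ≠ y, then θ[ S − N[y] ] < θ[ S ] whenever x, y ∈ S: induct on |S|
-- and look at the vertex v attaining the minimum in θ[ S ]; v = y is immediate, v = x
-- reduces to N[x] ⊆ N[y], and any other v is handled by the induction hypotheses for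
-- S − v and S − N[v].  For a neighbour z ≠ x of y, taking S = V − z gives
-- θ(G) ≤ max (θ(G − y), 1 + θ(G − N[y])) ≤ max (θ(G − y), θ(G − z)),
-- so in a θ-prime graph x is the only neighbour of y.
module Submission where

open import Defs hiding (sym)
open import Data.Bool using (Bool; true; false; T; if_then_else_)
open import Data.Bool.Properties using (T-≡; T-∧; T-∨)
open import Data.Fin using (Fin; _≟_)
open import Data.Fin.Subset using (Subset; _∈_; _∉_; _⊆_; _∩_; ∁; ⁅_⁆; ⊤; ∣_∣)
open import Data.Fin.Subset.Properties
  using (_∈?_; x∈p∩q⁺; x∈p∩q⁻; p∩q⊆p; x∉p⇒x∈∁p; x∈∁p⇒x∉p; ∩-assoc; ∩-comm; ∩-identityˡ;
         ∈⊤; x∈⁅x⁆; x∈⁅y⁆⇒x≡y; x≢y⇒x∉⁅y⁆; ∣⁅x⁆∣≡1; ∣p∣≤n; ⊆-antisym; p⊆q⇒∣p∣≤∣q∣; p⊂q⇒∣p∣<∣q∣)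
open import Data.List using ([]; _∷_; mapMaybe)
open import Data.List using () renaming (allFin to allFinL)
open import Data.List.Properties using (foldr-preservesᵒ; mapMaybe-cong)
open import Data.List.Membership.Propositional using () renaming (_∈_ to _∈ₗ_)
open import Data.List.Membership.Propositional.Properties using (∈-allFin; foldr-selective)
open import Data.List.Relation.Unary.Any as Any using (here; there)
open import Data.List.Relation.Unary.Any.Properties using (any⁺; any⁻; ¬Any[])
open import Data.Maybe using (Maybe; just; nothing)
open import Data.Nat using (ℕ; zero; suc; _≤_; _<_; _≥_; _⊓_; _⊔_; z≤n; s≤s)
open import Data.Nat.Induction using (<-wellFounded)
open import Data.Nat.Properties
  using (≤-refl; ≤-reflexive; ≤-trans; <-≤-trans; ≤-<-trans; ≤-pred; m≤n⇒m≤1+n; <-irrefl; n≮0; 1+n≰n;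
         m≤m⊔n; m≤n⊔m; ⊔-mono-≤; ⊔-monoʳ-≤; ⊔-lub; ⊓-sel; m≤n⇒m⊓o≤n; m≤n⇒o⊓m≤n; module ≤-Reasoning)
open import Data.Product using (∃-syntax; _×_; _,_; proj₁; proj₂)
open import Data.Sum using (_⊎_; inj₁; inj₂; [_,_])
open import Data.Vec using (tabulate; lookup)
open import Data.Vec.Properties using (lookup∘tabulate; []=⇒lookup; lookup⇒[]=)
open import Function using (_∘_; Equivalence)
open import Induction.WellFounded using (Acc; acc)
open import Relation.Binary.PropositionalEquality
  using (_≡_; _≢_; refl; sym; trans; cong; cong₂; subst; module ≡-Reasoning)
open import Relation.Nullary using (¬_; Dec; yes; no; contradiction)
open import Relation.Nullary.Decidable using (fromWitness; toWitness; map′; T?)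

module _ {A B : Set} (f : A → Maybe B) where

  ∈-mapMaybe⁺ : ∀ {x b} xs → x ∈ₗ xs → f x ≡ just b → b ∈ₗ mapMaybe f xs
  ∈-mapMaybe⁺ (x ∷ xs) (here refl) fx≡b rewrite fx≡b = here refl
  ∈-mapMaybe⁺ (y ∷ xs) (there x∈xs) fx≡b with f y
  ... | just _  = there (∈-mapMaybe⁺ xs x∈xs fx≡b)
  ... | nothing = ∈-mapMaybe⁺ xs x∈xs fx≡b

  ∈-mapMaybe⁻ : ∀ {b} xs → b ∈ₗ mapMaybe f xs → ∃[ x ] f x ≡ just b
  ∈-mapMaybe⁻ (x ∷ xs) b∈ with f x in fx≡
  ∈-mapMaybe⁻ (x ∷ xs) (here refl) | just _  = x , fx≡
  ∈-mapMaybe⁻ (x ∷ xs) (there b∈)  | just _  = ∈-mapMaybe⁻ xs b∈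
  ∈-mapMaybe⁻ (x ∷ xs) b∈          | nothing = ∈-mapMaybe⁻ xs b∈

module _ {n : ℕ} where

  infixl 5 _∖_
  _∖_ : Subset n → Subset n → Subset n
  p ∖ q = p ∩ ∁ q

  x∈p∖q⁺ : ∀ {x} {p q : Subset n} → x ∈ p → x ∉ q → x ∈ p ∖ q
  x∈p∖q⁺ x∈p x∉q = x∈p∩q⁺ (x∈p , x∉p⇒x∈∁p x∉q)

  p∖q⊆p : ∀ (p q : Subset n) → p ∖ q ⊆ p
  p∖q⊆p p q = p∩q⊆p p (∁ q)

  x∈p∖q⇒x∉q : ∀ {x} (p q : Subset n) → x ∈ p ∖ q → x ∉ q
  x∈p∖q⇒x∉q p q x∈p∖q = x∈∁p⇒x∉p (proj₂ (x∈p∩q⁻ p (∁ q) x∈p∖q))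

  ∖-monoˡ : ∀ {p p′} (q : Subset n) → p ⊆ p′ → p ∖ q ⊆ p′ ∖ q
  ∖-monoˡ {p} q p⊆p′ x∈ = x∈p∖q⁺ (p⊆p′ (p∖q⊆p p q x∈)) (x∈p∖q⇒x∉q p q x∈)

  ∖-antitoneʳ : ∀ (p : Subset n) {q q′} → q ⊆ q′ → p ∖ q′ ⊆ p ∖ q
  ∖-antitoneʳ p {q′ = q′} q⊆q′ x∈ = x∈p∖q⁺ (p∖q⊆p p q′ x∈) (x∈p∖q⇒x∉q p q′ x∈ ∘ q⊆q′)

  p∖q∖r≡p∖r∖q : ∀ (p q r : Subset n) → p ∖ q ∖ r ≡ p ∖ r ∖ q
  p∖q∖r≡p∖r∖q p q r = begin
    (p ∩ ∁ q) ∩ ∁ r  ≡⟨ ∩-assoc p (∁ q) (∁ r) ⟩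
    p ∩ (∁ q ∩ ∁ r)  ≡⟨ cong (p ∩_) (∩-comm (∁ q) (∁ r)) ⟩
    p ∩ (∁ r ∩ ∁ q)  ≡⟨ ∩-assoc p (∁ r) (∁ q) ⟨
    (p ∩ ∁ r) ∩ ∁ q  ∎
    where open ≡-Reasoning

  x∉p⇒p∖⁅x⁆≡p : ∀ {x} {p : Subset n} → x ∉ p → p ∖ ⁅ x ⁆ ≡ p
  x∉p⇒p∖⁅x⁆≡p {x} {p} x∉p = ⊆-antisym (p∖q⊆p p ⁅ x ⁆) λ y∈p →
    x∈p∖q⁺ y∈p λ y∈⁅x⁆ → x∉p (subst (_∈ p) (x∈⁅y⁆⇒x≡y x y∈⁅x⁆) y∈p)

  x∈q⇒p∖q⊆p∖⁅x⁆∖q : ∀ {x} (p q : Subset n) → x ∈ q → p ∖ q ⊆ p ∖ ⁅ x ⁆ ∖ q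
  x∈q⇒p∖q⊆p∖⁅x⁆∖q {x} p q x∈q y∈ =
    x∈p∖q⁺ (x∈p∖q⁺ (p∖q⊆p p q y∈) λ y∈⁅x⁆ → y∉q (subst (_∈ q) (sym (x∈⁅y⁆⇒x≡y x y∈⁅x⁆)) x∈q)) y∉q
    where y∉q = x∈p∖q⇒x∉q p q y∈

  ∣p∖q∣<∣p∣ : ∀ {x} {p q : Subset n} → x ∈ p → x ∈ q → ∣ p ∖ q ∣ < ∣ p ∣
  ∣p∖q∣<∣p∣ {x} {p} {q} x∈p x∈q =
    p⊂q⇒∣p∣<∣q∣ (p∖q⊆p p q , x , x∈p , λ x∈p∖q → x∈p∖q⇒x∉q p q x∈p∖q x∈q)

  T-lookup⇒∈ : ∀ {x} (p : Subset n) → T (lookup p x) → x ∈ p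
  T-lookup⇒∈ {x} p t = lookup⇒[]= x p (Equivalence.to T-≡ t)

  ∈⇒T-lookup : ∀ {x} {p : Subset n} → x ∈ p → T (lookup p x)
  ∈⇒T-lookup x∈p = Equivalence.from T-≡ ([]=⇒lookup x∈p)

  ∈-tabulate⁺ : ∀ {f : Fin n → Bool} {x} → T (f x) → x ∈ tabulate f
  ∈-tabulate⁺ {f} {x} t = T-lookup⇒∈ (tabulate f) (subst T (sym (lookup∘tabulate f x)) t)

  ∈-tabulate⁻ : ∀ {f : Fin n → Bool} {x} → x ∈ tabulate f → T (f x)
  ∈-tabulate⁻ {f} {x} x∈ = subst T (lookup∘tabulate f x) (∈⇒T-lookup x∈)

module _ {n : ℕ} (G : Graph n) where

  N[_] : Fin n → Subset n
  N[_] = closedNbhd G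

  θ[_] : Subset n → ℕ
  θ[_] = θ-induced G

  x∈N[x] : ∀ x → x ∈ N[ x ]
  x∈N[x] x = ∈-tabulate⁺ (Equivalence.from T-∨ (inj₁ (fromWitness {a? = x ≟ x} refl)))

  adj⇒∈N[] : ∀ {u v} → T (adj G u v) → u ∈ N[ v ]
  adj⇒∈N[] u~v = ∈-tabulate⁺ (Equivalence.from T-∨ (inj₂ u~v))

  ∈N[]⇒adj : ∀ {u v} → u ∈ N[ v ] → u ≢ v → T (adj G u v)
  ∈N[]⇒adj u∈ u≢v with Equivalence.to T-∨ (∈-tabulate⁻ u∈)
  ... | inj₁ u≡v = contradiction (toWitness u≡v) u≢v
  ... | inj₂ u~v = u~v

  ∈N[]-sym : ∀ {u v} → u ∈ N[ v ] → v ∈ N[ u ]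
  ∈N[]-sym {u} {v} u∈ with Equivalence.to T-∨ (∈-tabulate⁻ u∈)
  ... | inj₁ u≡v = subst (λ w → v ∈ N[ w ]) (sym (toWitness u≡v)) (x∈N[x] v)
  ... | inj₂ u~v = adj⇒∈N[] (subst T (Graph.sym G u v) u~v)

  adj⇒≢ : ∀ {u v} → T (adj G u v) → u ≢ v
  adj⇒≢ {u} u~u refl = subst T (irrefl G u) u~u

  NonIsolatedIn : Subset n → Fin n → Set
  NonIsolatedIn S v = v ∈ S × ∃[ u ] (u ∈ S × T (adj G v u))

  Edgeless : Subset n → Set
  Edgeless S = ∀ v → ¬ NonIsolatedIn S v

  NonIsolatedIn-mono : ∀ {S S′ v} → S ⊆ S′ → NonIsolatedIn S v → NonIsolatedIn S′ v
  NonIsolatedIn-mono S⊆S′ (v∈S , u , u∈S , v~u) = S⊆S′ v∈S , u , S⊆S′ u∈S , v~u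

  Edgeless-antitone : ∀ {S S′} → S ⊆ S′ → Edgeless S′ → Edgeless S
  Edgeless-antitone S⊆S′ edgeless v = edgeless v ∘ NonIsolatedIn-mono S⊆S′

  nonIsolatedIn-sound : ∀ {S v} → T (nonIsolatedIn G S v) → NonIsolatedIn S v
  nonIsolatedIn-sound {S} {v} t =
    let v∈S , some = Equivalence.to T-∧ t
        u , su     = Any.satisfied (any⁻ _ (allFinL n) some)
        u∈S , v~u  = Equivalence.to T-∧ su
    in T-lookup⇒∈ S v∈S , u , T-lookup⇒∈ S u∈S , v~u

  nonIsolatedIn-complete : ∀ {S v} → NonIsolatedIn S v → T (nonIsolatedIn G S v)
  nonIsolatedIn-complete (v∈S , u , u∈S , v~u) = Equivalence.from T-∧
    (∈⇒T-lookup v∈S , any⁺ _ (Any.map (λ { refl → Equivalence.from T-∧ (∈⇒T-lookup u∈S , v~u) })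
                                      (∈-allFin u)))

  minList-≤ : ∀ {a} xs → a ∈ₗ xs → minList G xs ≤ a
  minList-≤ {a} (x ∷ xs) a∈ = foldr-preservesᵒ {P = _≤ a} ⊓-≤ x xs (split a∈)
    where
    ⊓-≤ : ∀ b c → b ≤ a ⊎ c ≤ a → b ⊓ c ≤ a
    ⊓-≤ b c = [ m≤n⇒m⊓o≤n c , m≤n⇒o⊓m≤n b ]
    split : a ∈ₗ x ∷ xs → x ≤ a ⊎ Any.Any (_≤ a) xs
    split (here refl)  = inj₁ ≤-refl
    split (there a∈xs) = inj₂ (Any.map (λ { refl → ≤-refl }) a∈xs)

  minList-∈ : ∀ xs → xs ≡ [] ⊎ minList G xs ∈ₗ xs
  minList-∈ []       = inj₁ refl
  minList-∈ (x ∷ xs) with foldr-selective ⊓-sel x xs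
  ... | inj₁ min≡x   = inj₂ (here min≡x)
  ... | inj₂ min∈xs = inj₂ (there min∈xs)

  branch : ℕ → Subset n → Fin n → ℕ
  branch k S v = θ-fuel G k (S ∖ ⁅ v ⁆) ⊔ suc (θ-fuel G k (S ∖ N[ v ]))

  -- The candidate values of θ-fuel, so that θ-fuel G (suc k) S unfolds definitionally
  -- to minList G (mapMaybe (candidate k S) (allFinL n)).
  candidate : ℕ → Subset n → Fin n → Maybe ℕ
  candidate k S v = if nonIsolatedIn G S v then just (branch k S v) else nothing

  candidate-just : ∀ k {S v b} → candidate k S v ≡ just b → NonIsolatedIn S v × branch k S v ≡ b
  candidate-just k {S} {v} eq with nonIsolatedIn G S v in ni
  candidate-just k refl | true = nonIsolatedIn-sound (Equivalence.from T-≡ ni) , refl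

  candidate-nonIsolated : ∀ k {S v} → NonIsolatedIn S v → candidate k S v ≡ just (branch k S v)
  candidate-nonIsolated k {S} {v} ni with nonIsolatedIn G S v | nonIsolatedIn-complete ni
  ... | true | _ = refl

  θ-fuel-suc-≤ : ∀ k {S v} → NonIsolatedIn S v → θ-fuel G (suc k) S ≤ branch k S v
  θ-fuel-suc-≤ k {S} {v} ni =
    minList-≤ _ (∈-mapMaybe⁺ (candidate k S) (allFinL n) (∈-allFin v) (candidate-nonIsolated k ni))

  θ-fuel-suc-cases : ∀ k S → (Edgeless S × θ-fuel G (suc k) S ≡ 0)
                           ⊎ ∃[ v ] (NonIsolatedIn S v × θ-fuel G (suc k) S ≡ branch k S v)
  θ-fuel-suc-cases k S with minList-∈ (mapMaybe (candidate k S) (allFinL n))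
  ... | inj₁ none = inj₁ (edgeless , cong (minList G) none)
    where
    edgeless : Edgeless S
    edgeless v ni = ¬Any[] (subst (branch k S v ∈ₗ_) none
      (∈-mapMaybe⁺ (candidate k S) (allFinL n) (∈-allFin v) (candidate-nonIsolated k ni)))
  ... | inj₂ min∈ =
    let v , candidate≡ = ∈-mapMaybe⁻ (candidate k S) (allFinL n) min∈
        ni , branch≡   = candidate-just k candidate≡
    in inj₂ (v , ni , sym branch≡)

  θ-fuel-empty : ∀ k {S} → ∣ S ∣ ≤ 0 → θ-fuel G k S ≡ 0
  θ-fuel-empty zero    _     = refl
  θ-fuel-empty (suc k) {S} ∣S∣≤0 with θ-fuel-suc-cases k S
  ... | inj₁ (_ , θ≡0)             = θ≡0
  ... | inj₂ (v , (v∈S , _) , _) = contradiction (<-≤-trans (∣p∖q∣<∣p∣ v∈S (x∈⁅x⁆ v)) ∣S∣≤0) n≮0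

  θ-fuel-agree : ∀ j k {S} → ∣ S ∣ ≤ j → ∣ S ∣ ≤ k → θ-fuel G j S ≡ θ-fuel G k S
  θ-fuel-agree zero    k       ∣S∣≤0 _     = sym (θ-fuel-empty k ∣S∣≤0)
  θ-fuel-agree (suc j) zero    _     ∣S∣≤0 = θ-fuel-empty (suc j) ∣S∣≤0
  θ-fuel-agree (suc j) (suc k) {S} ∣S∣≤1+j ∣S∣≤1+k =
    cong (minList G) (mapMaybe-cong candidates-agree (allFinL n))
    where
    shrink : ∀ {m v A} → v ∈ S → v ∈ A → ∣ S ∣ ≤ suc m → ∣ S ∖ A ∣ ≤ m
    shrink v∈S v∈A ∣S∣≤1+m = ≤-pred (<-≤-trans (∣p∖q∣<∣p∣ v∈S v∈A) ∣S∣≤1+m)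
    candidates-agree : ∀ v → candidate j S v ≡ candidate k S v
    candidates-agree v with nonIsolatedIn G S v in ni
    ... | false = refl
    ... | true  = cong just (cong₂ (λ a b → a ⊔ suc b)
      (θ-fuel-agree j k (shrink v∈S (x∈⁅x⁆ v) ∣S∣≤1+j) (shrink v∈S (x∈⁅x⁆ v) ∣S∣≤1+k))
      (θ-fuel-agree j k (shrink v∈S (x∈N[x] v) ∣S∣≤1+j) (shrink v∈S (x∈N[x] v) ∣S∣≤1+k)))
      where v∈S = proj₁ (nonIsolatedIn-sound (Equivalence.from T-≡ ni))

  θ≡θ-fuel-suc : ∀ S → θ[ S ] ≡ θ-fuel G (suc n) S
  θ≡θ-fuel-suc S = θ-fuel-agree n (suc n) (∣p∣≤n S) (m≤n⇒m≤1+n (∣p∣≤n S))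

  θ-≤-nonIsolated-branch : ∀ {S v} → NonIsolatedIn S v →
                           θ[ S ] ≤ θ[ S ∖ ⁅ v ⁆ ] ⊔ suc θ[ S ∖ N[ v ] ]
  θ-≤-nonIsolated-branch {S} ni = ≤-trans (≤-reflexive (θ≡θ-fuel-suc S)) (θ-fuel-suc-≤ n ni)

  θ-cases : ∀ S → Edgeless S
                ⊎ ∃[ v ] (NonIsolatedIn S v × θ[ S ] ≡ θ[ S ∖ ⁅ v ⁆ ] ⊔ suc θ[ S ∖ N[ v ] ])
  θ-cases S with θ-fuel-suc-cases n S
  ... | inj₁ (edgeless , _) = inj₁ edgeless
  ... | inj₂ (v , ni , θ≡)  = inj₂ (v , ni , trans (θ≡θ-fuel-suc S) θ≡)

  θ-edgeless : ∀ {S} → Edgeless S → θ[ S ] ≡ 0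
  θ-edgeless {S} edgeless with θ-fuel-suc-cases n S
  ... | inj₁ (_ , θ≡0)     = trans (θ≡θ-fuel-suc S) θ≡0
  ... | inj₂ (v , ni , _) = contradiction ni (edgeless v)

  nonIsolated? : ∀ S v → Dec (NonIsolatedIn S v)
  nonIsolated? S v = map′ nonIsolatedIn-sound nonIsolatedIn-complete (T? (nonIsolatedIn G S v))

  θ-≤-isolated : ∀ {S v} → v ∈ S → ¬ NonIsolatedIn S v → θ[ S ] ≤ θ[ S ∖ ⁅ v ⁆ ]
  θ-≤-isolated {S} = go (<-wellFounded ∣ S ∣)
    where
    go : ∀ {S v} → Acc _<_ ∣ S ∣ → v ∈ S → ¬ NonIsolatedIn S v → θ[ S ] ≤ θ[ S ∖ ⁅ v ⁆ ]
    go {S} {v} (acc rs) v∈S isolated with θ-cases (S ∖ ⁅ v ⁆)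
    ... | inj₁ edgeless = ≤-trans (≤-reflexive (θ-edgeless S-edgeless)) z≤n
      where
      ≢v : ∀ {u w} → w ∈ S → T (adj G u w) → u ≢ v
      ≢v w∈S u~w refl = isolated (v∈S , _ , w∈S , u~w)
      S-edgeless : Edgeless S
      S-edgeless w (w∈S , u , u∈S , w~u) = edgeless w
        ( x∈p∖q⁺ w∈S (x≢y⇒x∉⁅y⁆ (≢v u∈S w~u)) , u
        , x∈p∖q⁺ u∈S (x≢y⇒x∉⁅y⁆ (≢v w∈S (subst T (Graph.sym G w u) w~u))) , w~u )
    ... | inj₂ (w , ni , θ≡) = begin
      θ[ S ]
        ≤⟨ θ-≤-nonIsolated-branch (NonIsolatedIn-mono (p∖q⊆p S ⁅ v ⁆) ni) ⟩
      θ[ S ∖ ⁅ w ⁆ ] ⊔ suc θ[ S ∖ N[ w ] ]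
        ≤⟨ ⊔-mono-≤ (ih (x∈⁅x⁆ w) v∉⁅w⁆) (s≤s (ih (x∈N[x] w) v∉N[w])) ⟩
      θ[ S ∖ ⁅ w ⁆ ∖ ⁅ v ⁆ ] ⊔ suc θ[ S ∖ N[ w ] ∖ ⁅ v ⁆ ]
        ≡⟨ cong₂ (λ A B → θ[ A ] ⊔ suc θ[ B ])
                 (p∖q∖r≡p∖r∖q S ⁅ w ⁆ ⁅ v ⁆) (p∖q∖r≡p∖r∖q S N[ w ] ⁅ v ⁆) ⟩
      θ[ S ∖ ⁅ v ⁆ ∖ ⁅ w ⁆ ] ⊔ suc θ[ S ∖ ⁅ v ⁆ ∖ N[ w ] ]
        ≡⟨ θ≡ ⟨
      θ[ S ∖ ⁅ v ⁆ ]
        ∎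
      where
      open ≤-Reasoning
      w∈S∖v : w ∈ S ∖ ⁅ v ⁆
      w∈S∖v = proj₁ ni
      w∈S : w ∈ S
      w∈S = p∖q⊆p S ⁅ v ⁆ w∈S∖v
      v≢w : v ≢ w
      v≢w refl = x∈p∖q⇒x∉q S ⁅ v ⁆ w∈S∖v (x∈⁅x⁆ v)
      v∉⁅w⁆ : v ∉ ⁅ w ⁆
      v∉⁅w⁆ = x≢y⇒x∉⁅y⁆ v≢w
      v∉N[w] : v ∉ N[ w ]
      v∉N[w] v∈N[w] = isolated (v∈S , w , w∈S , ∈N[]⇒adj v∈N[w] v≢w)
      ih : ∀ {A} → w ∈ A → v ∉ A → θ[ S ∖ A ] ≤ θ[ S ∖ A ∖ ⁅ v ⁆ ]
      ih {A} w∈A v∉A = go (rs (∣p∖q∣<∣p∣ w∈S w∈A)) (x∈p∖q⁺ v∈S v∉A)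
                         (isolated ∘ NonIsolatedIn-mono (p∖q⊆p S A))

  θ-≤-branch : ∀ S v → θ[ S ] ≤ θ[ S ∖ ⁅ v ⁆ ] ⊔ suc θ[ S ∖ N[ v ] ]
  θ-≤-branch S v with v ∈? S | nonIsolated? S v
  ... | no v∉S  | _           = ≤-trans (≤-reflexive (cong θ[_] (sym (x∉p⇒p∖⁅x⁆≡p v∉S)))) (m≤m⊔n _ _)
  ... | yes _   | yes ni      = θ-≤-nonIsolated-branch ni
  ... | yes v∈S | no isolated = ≤-trans (θ-≤-isolated v∈S isolated) (m≤m⊔n _ _)

  θ-mono : ∀ {A B} → A ⊆ B → θ[ A ] ≤ θ[ B ]
  θ-mono {B = B} = go (<-wellFounded ∣ B ∣)
    where
    go : ∀ {A B} → Acc _<_ ∣ B ∣ → A ⊆ B → θ[ A ] ≤ θ[ B ]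
    go {A} {B} (acc rs) A⊆B with θ-cases B
    ... | inj₁ edgeless = ≤-trans (≤-reflexive (θ-edgeless (Edgeless-antitone A⊆B edgeless))) z≤n
    ... | inj₂ (v , (v∈B , _) , θ≡) = begin
      θ[ A ]                                ≤⟨ θ-≤-branch A v ⟩
      θ[ A ∖ ⁅ v ⁆ ] ⊔ suc θ[ A ∖ N[ v ] ] ≤⟨ ⊔-mono-≤ (ih (x∈⁅x⁆ v)) (s≤s (ih (x∈N[x] v))) ⟩
      θ[ B ∖ ⁅ v ⁆ ] ⊔ suc θ[ B ∖ N[ v ] ] ≡⟨ θ≡ ⟨
      θ[ B ]                                ∎
      where
      open ≤-Reasoning
      ih : ∀ {C} → v ∈ C → θ[ A ∖ C ] ≤ θ[ B ∖ C ]
      ih {C} v∈C = go (rs (∣p∖q∣<∣p∣ v∈B v∈C)) (∖-monoˡ C A⊆B)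

  module _ {x y : Fin n} (x≢y : x ≢ y) (Nx⊆Ny : N[ x ] ⊆ N[ y ]) where

    θ-∖N[dominator]<θ : ∀ {S} → x ∈ S → y ∈ S → θ[ S ∖ N[ y ] ] < θ[ S ]
    θ-∖N[dominator]<θ {S} = go (<-wellFounded ∣ S ∣)
      where
      x~y : T (adj G x y)
      x~y = ∈N[]⇒adj (Nx⊆Ny (x∈N[x] x)) x≢y
      go : ∀ {S} → Acc _<_ ∣ S ∣ → x ∈ S → y ∈ S → θ[ S ∖ N[ y ] ] < θ[ S ]
      go {S} (acc rs) x∈S y∈S with θ-cases S
      ... | inj₁ edgeless = contradiction (x∈S , y , y∈S , x~y) (edgeless x)
      ... | inj₂ (v , (v∈S , _) , θ≡) =
        subst (θ[ S ∖ N[ y ] ] <_) (sym θ≡) (below-branch (v ∈? N[ y ]))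
        where
        open ≤-Reasoning
        ih : ∀ {A} → v ∈ A → x ∉ A → y ∉ A → θ[ S ∖ A ∖ N[ y ] ] < θ[ S ∖ A ]
        ih v∈A x∉A y∉A = go (rs (∣p∖q∣<∣p∣ v∈S v∈A)) (x∈p∖q⁺ x∈S x∉A) (x∈p∖q⁺ y∈S y∉A)
        below-branch : Dec (v ∈ N[ y ]) → θ[ S ∖ N[ y ] ] < θ[ S ∖ ⁅ v ⁆ ] ⊔ suc θ[ S ∖ N[ v ] ]
        below-branch (yes v∈Ny) with v ≟ y | v ≟ x
        ... | yes refl | _        = m≤n⊔m _ _
        ... | no _     | yes refl = ≤-trans (s≤s (θ-mono (∖-antitoneʳ S Nx⊆Ny))) (m≤n⊔m _ _)
        ... | no v≢y   | no v≢x   = begin-strict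
          θ[ S ∖ N[ y ] ]            ≤⟨ θ-mono (x∈q⇒p∖q⊆p∖⁅x⁆∖q S N[ y ] v∈Ny) ⟩
          θ[ S ∖ ⁅ v ⁆ ∖ N[ y ] ]   <⟨ ih (x∈⁅x⁆ v) (x≢y⇒x∉⁅y⁆ (v≢x ∘ sym)) (x≢y⇒x∉⁅y⁆ (v≢y ∘ sym)) ⟩
          θ[ S ∖ ⁅ v ⁆ ]             ≤⟨ m≤m⊔n _ _ ⟩
          θ[ S ∖ ⁅ v ⁆ ] ⊔ suc θ[ S ∖ N[ v ] ] ∎
        below-branch (no v∉Ny) = begin
          suc θ[ S ∖ N[ y ] ]
            ≤⟨ s≤s (θ-≤-branch (S ∖ N[ y ]) v) ⟩
          suc (θ[ S ∖ N[ y ] ∖ ⁅ v ⁆ ] ⊔ suc θ[ S ∖ N[ y ] ∖ N[ v ] ])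
            ≡⟨ cong₂ (λ A B → suc (θ[ A ] ⊔ suc θ[ B ]))
                     (p∖q∖r≡p∖r∖q S N[ y ] ⁅ v ⁆) (p∖q∖r≡p∖r∖q S N[ y ] N[ v ]) ⟩
          suc θ[ S ∖ ⁅ v ⁆ ∖ N[ y ] ] ⊔ suc (suc θ[ S ∖ N[ v ] ∖ N[ y ] ])
            ≤⟨ ⊔-mono-≤ (ih (x∈⁅x⁆ v) (∉⁅v⁆ (Nx⊆Ny (x∈N[x] x))) (∉⁅v⁆ (x∈N[x] y)))
                        (s≤s (ih (x∈N[x] v) (v∉Ny ∘ Nx⊆Ny ∘ ∈N[]-sym) (v∉Ny ∘ ∈N[]-sym))) ⟩
          θ[ S ∖ ⁅ v ⁆ ] ⊔ suc θ[ S ∖ N[ v ] ] ∎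
          where
          ∉⁅v⁆ : ∀ {u} → u ∈ N[ y ] → u ∉ ⁅ v ⁆
          ∉⁅v⁆ u∈Ny u∈⁅v⁆ = v∉Ny (subst (_∈ N[ y ]) (x∈⁅y⁆⇒x≡y v u∈⁅v⁆) u∈Ny)

    θ≤θ-del⊔θ-del : ∀ {z} → T (adj G y z) → z ≢ x → θ G ≤ θ-del G y ⊔ θ-del G z
    θ≤θ-del⊔θ-del {z} y~z z≢x = begin
      θ[ ⊤ ]
        ≤⟨ θ-≤-branch ⊤ y ⟩
      θ[ ⊤ ∖ ⁅ y ⁆ ] ⊔ suc θ[ ⊤ ∖ N[ y ] ]
        ≤⟨ ⊔-monoʳ-≤ θ[ ⊤ ∖ ⁅ y ⁆ ] (s≤s (θ-mono ⊤∖Ny⊆⊤∖z∖Ny)) ⟩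
      θ[ ⊤ ∖ ⁅ y ⁆ ] ⊔ suc θ[ ⊤ ∖ ⁅ z ⁆ ∖ N[ y ] ]
        ≤⟨ ⊔-monoʳ-≤ θ[ ⊤ ∖ ⁅ y ⁆ ] (θ-∖N[dominator]<θ x∈⊤∖z y∈⊤∖z) ⟩
      θ[ ⊤ ∖ ⁅ y ⁆ ] ⊔ θ[ ⊤ ∖ ⁅ z ⁆ ]
        ≡⟨ cong₂ (λ A B → θ[ A ] ⊔ θ[ B ]) (∩-identityˡ _) (∩-identityˡ _) ⟩
      θ-del G y ⊔ θ-del G z
        ∎
      where
      open ≤-Reasoning
      ⊤∖Ny⊆⊤∖z∖Ny : ⊤ ∖ N[ y ] ⊆ ⊤ ∖ ⁅ z ⁆ ∖ N[ y ]
      ⊤∖Ny⊆⊤∖z∖Ny = x∈q⇒p∖q⊆p∖⁅x⁆∖q ⊤ N[ y ] (adj⇒∈N[] (subst T (Graph.sym G y z) y~z))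
      x∈⊤∖z : x ∈ ⊤ ∖ ⁅ z ⁆
      x∈⊤∖z = x∈p∖q⁺ ∈⊤ (x≢y⇒x∉⁅y⁆ (z≢x ∘ sym))
      y∈⊤∖z : y ∈ ⊤ ∖ ⁅ z ⁆
      y∈⊤∖z = x∈p∖q⁺ ∈⊤ (x≢y⇒x∉⁅y⁆ (adj⇒≢ y~z))

    θ-prime⇒neighbour≡x : θ-prime G → ∀ {z} → z ∈ openNbhd G y → z ≡ x
    θ-prime⇒neighbour≡x prime {z} z∈ with z ≟ x
    ... | yes z≡x = z≡x
    ... | no z≢x  = contradiction
      (≤-<-trans (θ≤θ-del⊔θ-del (∈-tabulate⁻ z∈) z≢x) (⊔-lub (prime y) (prime z))) (<-irrefl refl)

proposition47 : ∀ {n} (G : Graph n) (x y : Fin n) → x ≢ y →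
    closedNbhd G x ⊆ closedNbhd G y → deg G y ≥ 2 → ¬ θ-prime G
proposition47 G x y x≢y Nx⊆Ny deg≥2 prime = 1+n≰n (≤-trans deg≥2 deg≤1)
  where
  deg≤1 : deg G y ≤ 1
  deg≤1 = subst (deg G y ≤_) (∣⁅x⁆∣≡1 x) (p⊆q⇒∣p∣≤∣q∣ λ z∈ →
    subst (_∈ ⁅ x ⁆) (sym (θ-prime⇒neighbour≡x G x≢y Nx⊆Ny prime z∈)) (x∈⁅x⁆ x))
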